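{- For every graph $H$, $c_f(H)\ge c_T(H)$.
   Context: All graphs are finite and simple; $\mathsf{d}(G)=\mathsf{e}(G)/\mathsf{v}(G)$; $\tau(H)$ is the minimum size of a vertex cover of $H$; $\alpha_k(H)$ is the maximum $|X|$ over $X\subseteq V(H)$ with $\chi(H[X])\le k$. $c_T(H)=\sup\left(\{\tau(H)\}\cup\left\{\frac{i-1}{i}\left(\mathsf{v}(H)-\frac{\alpha_i(H)}{2}\right):i\ge2\right\}\right)$. A jumbled model of $H$ in $G$ is a map $\mu$ from $V(H)$ to subsets of $V(G)$ such that each $G[\mu(v)]$ is connected (and nonempty) and for every edge $uv\in E(H)$ some edge of $G$ joins $\mu(u)$ and $\mu(v)$ (overlaps allowed); $\mu^{\#}(x)=|\{v:x\in\mu(v)\}|$. $\mathrm{Vol}_H(G)$ is the supremum of $\sum_i\alpha_i$ over finitely many reals $\alpha_i\ge0$ and jumbled models $\mu_i$ of $H$ in $G$ with $\sum_i\alpha_i\mu_i^{\#}(x)\le1$ for all $x$. $c_f(H)=\sup_G\mathsf{d}(G)/\mathrm{Vol}_H(G)$ over non-null graphs $G$.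
   Formalization: The weights $\alpha_i$ of the jumbled models in $\mathrm{Vol}_H(G)$ are rational instead of real. -}

module Defs where

open import Data.Bool using (Bool; true; false; if_then_else_; _∧_)
open import Data.Nat using (ℕ; zero; suc; _<ᵇ_)
open import Data.Fin using (Fin; toℕ)
open import Data.Fin.Subset using (Subset; _∈_; ∣_∣)
open import Data.Vec using (lookup)
open import Data.List using (List; []; _∷_; map; allFin)
open import Data.Nat.ListAction using (sum)
open import Data.List.Relation.Unary.All using (All)
open import Data.Integer using (+_)
open import Data.Rational using (ℚ; _/_; _+_; _*_; _-_; _≤_; 0ℚ; 1ℚ)
open import Data.Product using (Σ; _×_; _,_; proj₁; proj₂; ∃)
open import Data.Sum using (_⊎_)
open import Relation.Binary.PropositionalEquality using (_≡_; _≢_)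

record Graph (n : ℕ) : Set where
  field
    adj    : Fin n → Fin n → Bool
    sym    : ∀ u v → adj u v ≡ adj v u
    irrefl : ∀ u → adj u u ≡ false
open Graph public

e : ∀ {n} → Graph n → ℕ
e {n} G = sum (map (λ u → sum (map (λ v →
            if (toℕ u <ᵇ toℕ v) ∧ adj G u v then 1 else 0) (allFin n))) (allFin n))

d : ∀ {m} → Graph (suc m) → ℚ
d {m} G = + e G / suc m

ℕ→ℚ : ℕ → ℚ
ℕ→ℚ k = + k / 1

IsVertexCover : ∀ {n} → Graph n → Subset n → Set
IsVertexCover H C = ∀ u v → adj H u v ≡ true → (u ∈ C) ⊎ (v ∈ C)

IsTau : ∀ {n} → Graph n → ℕ → Set
IsTau H k = (Σ _ λ C → IsVertexCover H C × ∣ C ∣ ≡ k)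
          × (∀ C → IsVertexCover H C → k Data.Nat.≤ ∣ C ∣)

ChiLe : ∀ {n} → Graph n → Subset n → ℕ → Set
ChiLe {n} H X k = Σ (Fin n → Fin k) λ c →
  ∀ u v → u ∈ X → v ∈ X → adj H u v ≡ true → c u ≢ c v

IsAlpha : ∀ {n} → Graph n → ℕ → ℕ → Set
IsAlpha H k a = (Σ _ λ X → ChiLe H X k × ∣ X ∣ ≡ a)
              × (∀ X → ChiLe H X k → ∣ X ∣ Data.Nat.≤ a)

-- s is one of the numbers whose supremum is c_T(H):
--   s = τ(H), or s = ((i-1)/i)(v(H) - α_i(H)/2) for some i ≥ 2 (written i = j+2)
CTCandidate : ∀ {n} → Graph n → ℚ → Set
CTCandidate {n} H s =
    (Σ ℕ λ k → IsTau H k × s ≡ ℕ→ℚ k)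
  ⊎ (Σ ℕ λ j → Σ ℕ λ a → IsAlpha H (suc (suc j)) a ×
       s ≡ (+ (suc j) / suc (suc j)) * (ℕ→ℚ n - + a / 2))

data PathIn {m} (G : Graph m) (S : Subset m) : Fin m → Fin m → Set where
  here : ∀ {x} → PathIn G S x x
  step : ∀ {x z y} → adj G x z ≡ true → z ∈ S → PathIn G S z y → PathIn G S x y

ConnectedNonempty : ∀ {m} → Graph m → Subset m → Set
ConnectedNonempty G S = (∃ λ x → x ∈ S) × (∀ x y → x ∈ S → y ∈ S → PathIn G S x y)

record Model {n m} (H : Graph n) (G : Graph m) : Set where
  field
    μ    : Fin n → Subset m
    conn : ∀ v → ConnectedNonempty G (μ v)
    edge : ∀ u v → adj H u v ≡ true →
           Σ (Fin m) λ x → Σ (Fin m) λ y → x ∈ μ u × y ∈ μ v × adj G x y ≡ true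
open Model public

mult : ∀ {n m} {H : Graph n} {G : Graph m} → Model H G → Fin m → ℕ
mult {n} M x = sum (map (λ v → if lookup (μ M v) x then 1 else 0) (allFin n))

total : ∀ {n m} {H : Graph n} {G : Graph m} → List (ℚ × Model H G) → ℚ
total []             = 0ℚ
total ((α , _) ∷ P) = α + total P

load : ∀ {n m} {H : Graph n} {G : Graph m} → List (ℚ × Model H G) → Fin m → ℚ
load []             x = 0ℚ
load ((α , M) ∷ P) x = α * ℕ→ℚ (mult M x) + load P x

Packing : ∀ {n m} {H : Graph n} {G : Graph m} → List (ℚ × Model H G) → Set
Packing {m = m} P = All (λ p → 0ℚ ≤ proj₁ p) P × (∀ (x : Fin m) → load P x ≤ 1ℚ)

-- τ(H): in a star every edge meets the centre, so in any jumbled model the branch sets containing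
-- the centre index a vertex cover of H.  The centre thus carries load at least τ(H) times the total
-- weight of a packing, which is therefore at most 1/τ(H), while the density K/(K+1) of the star
-- K_{1,K} tends to 1.
-- α_i(H): in K_i, colouring each singleton branch set by its vertex properly i-colours the
-- subgraph of H they induce, so at most α_i(H) branch sets are singletons and every model uses at
-- least 2v(H) − α_i(H) vertex slots.  Summing the load over the i vertices bounds the total weight
-- by i/(2v(H) − α_i(H)), against the density (i − 1)/2 of K_i.
module Submission where

open import Defs hiding (sym)
open import Data.Nat using (ℕ; suc)
open import Data.List using (List)
open import Data.Product using (Σ; _×_)
open import Data.Rational using (ℚ; _-_; _*_; _≤_; _<_; 0ℚ)

open import Data.Bool using (Bool; true; false; not; _∧_; if_then_else_)
open import Data.Bool.Properties using (∧-zeroʳ; T-≡)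
open import Data.Nat as ℕ using (zero; z≤n; s≤s; _≤ᵇ_; _<ᵇ_)
import Data.Nat.Properties as ℕ
import Data.Nat.Tactic.RingSolver as ℕ-Solver
open import Data.Nat.ListAction using () renaming (sum to sumᴸ)
open import Algebra.Properties.CommutativeMonoid.Sum ℕ.+-0-commutativeMonoid
  using (sum-syntax; sum-cong-≗; ∑-comm; ∑-distrib-+)
open import Data.Fin using (Fin; zero; suc; toℕ)
open import Data.Fin.Properties using (_≟_)
open import Data.Fin.Subset as Subset using (Subset; _∈_; ∣_∣; ⊥; inside)
open import Data.Fin.Subset.Properties using (x∈p⇒∣p-x∣<∣p∣; x∈p∧x∉q⇒x∈p─q; x∈⁅y⁆⇒x≡y; ∉⊥)
open import Data.Vec using (lookup; tabulate; []; _∷_; here; there)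
open import Data.Vec.Properties using (lookup∘tabulate; []=⇒lookup; lookup⇒[]=)
open import Data.List as List using ([]; _∷_)
import Data.List.Properties as List
open import Data.List.Relation.Unary.All using (All; []; _∷_)
open import Data.Integer as ℤ using (+_; +[1+_])
import Data.Integer.Tactic.RingSolver as ℤ-Solver
open import Data.Rational
  using (mkℚ; _/_; _+_; -_; 1ℚ; toℚᵘ; Positive; positive; nonNegative)
open import Data.Rational.Properties
  using ( toℚᵘ-injective; toℚᵘ-fromℚᵘ; fromℚᵘ-toℚᵘ; toℚᵘ-homo-+; toℚᵘ-homo-*
        ; +-identityˡ; +-identityʳ; +-assoc; *-zeroˡ; *-zeroʳ; *-identityʳ; *-comm; *-distribˡ-+
        ; normalize-nonNeg; normalize-pos; nonNegative⁻¹; nonNeg*nonNeg⇒nonNeg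
        ; ≤-refl; ≤-reflexive; ≤-trans; <⇒≤; module ≤-Reasoning
        ; +-mono-≤; +-monoˡ-≤; +-monoʳ-≤; neg-antimono-≤
        ; *-monoˡ-≤-nonNeg; *-monoʳ-≤-nonNeg; *-cancelˡ-≤-pos )
open import Data.Rational.Unnormalised as ℚᵘ using (mkℚᵘ; *≡*)
import Data.Rational.Unnormalised.Properties as ℚᵘ
open import Data.Rational.Solver using (module +-*-Solver)
open import Data.Product using (_,_; proj₁; proj₂)
open import Data.Sum using (_⊎_; inj₁; inj₂)
open import Data.Empty using (⊥-elim)
open import Function using (id; _∘_; case_of_; Equivalence)
open import Relation.Nullary using (does; yes; no; contradiction)
open import Relation.Nullary.Decidable using (dec-true; dec-false)
open import Relation.Binary.PropositionalEquality

open +-*-Solver using (solve; _:+_; _:*_; _:-_; _:=_; con)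

toℚᵘ-ℕ→ℚ : ∀ k → toℚᵘ (ℕ→ℚ k) ℚᵘ.≃ mkℚᵘ (+ k) 0
toℚᵘ-ℕ→ℚ k = toℚᵘ-fromℚᵘ (mkℚᵘ (+ k) 0)

ℕ→ℚ-suc : ∀ k → ℕ→ℚ (suc k) ≡ 1ℚ + ℕ→ℚ k
ℕ→ℚ-suc k = toℚᵘ-injective (begin-equality
  toℚᵘ (ℕ→ℚ (suc k))        ≃⟨ toℚᵘ-ℕ→ℚ (suc k) ⟩
  mkℚᵘ (+ suc k) 0           ≃⟨ *≡* (ℤ-identity (+ k)) ⟩
  ℚᵘ.1ℚᵘ ℚᵘ.+ mkℚᵘ (+ k) 0   ≃⟨ ℚᵘ.+-congʳ ℚᵘ.1ℚᵘ (ℚᵘ.≃-sym (toℚᵘ-ℕ→ℚ k)) ⟩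
  ℚᵘ.1ℚᵘ ℚᵘ.+ toℚᵘ (ℕ→ℚ k)   ≃⟨ ℚᵘ.≃-sym (toℚᵘ-homo-+ 1ℚ (ℕ→ℚ k)) ⟩
  toℚᵘ (1ℚ + ℕ→ℚ k)          ∎)
  where
  open ℚᵘ.≤-Reasoning
  ℤ-identity : ∀ x → (ℤ.1ℤ ℤ.+ x) ℤ.* (ℤ.1ℤ ℤ.* ℤ.1ℤ) ≡ (ℤ.1ℤ ℤ.* ℤ.1ℤ ℤ.+ x ℤ.* ℤ.1ℤ) ℤ.* ℤ.1ℤ
  ℤ-identity = ℤ-Solver.solve-∀

ℕ→ℚ-*-/ : ∀ n d → ℕ→ℚ (suc d) * (+ n / suc d) ≡ ℕ→ℚ n
ℕ→ℚ-*-/ n d = toℚᵘ-injective (begin-equality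
  toℚᵘ (ℕ→ℚ (suc d) * (+ n / suc d))                 ≃⟨ toℚᵘ-homo-* (ℕ→ℚ (suc d)) (+ n / suc d) ⟩
  toℚᵘ (ℕ→ℚ (suc d)) ℚᵘ.* toℚᵘ (+ n / suc d)          ≃⟨ ℚᵘ.*-cong (toℚᵘ-ℕ→ℚ (suc d)) (toℚᵘ-fromℚᵘ (mkℚᵘ (+ n) d)) ⟩
  mkℚᵘ (+ suc d) 0 ℚᵘ.* mkℚᵘ (+ n) d                  ≃⟨ *≡* (ℤ-identity (+ suc d) (+ n)) ⟩
  mkℚᵘ (+ n) 0                                        ≃⟨ ℚᵘ.≃-sym (toℚᵘ-ℕ→ℚ n) ⟩
  toℚᵘ (ℕ→ℚ n)                                        ∎)
  where
  open ℚᵘ.≤-Reasoning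
  ℤ-identity : ∀ x y → (x ℤ.* y) ℤ.* ℤ.1ℤ ≡ y ℤ.* (ℤ.1ℤ ℤ.* x)
  ℤ-identity = ℤ-Solver.solve-∀

ℕ→ℚ-+ : ∀ a b → ℕ→ℚ (a ℕ.+ b) ≡ ℕ→ℚ a + ℕ→ℚ b
ℕ→ℚ-+ zero    b = sym (+-identityˡ (ℕ→ℚ b))
ℕ→ℚ-+ (suc a) b = begin
  ℕ→ℚ (suc (a ℕ.+ b))        ≡⟨ ℕ→ℚ-suc (a ℕ.+ b) ⟩
  1ℚ + ℕ→ℚ (a ℕ.+ b)         ≡⟨ cong (λ x → 1ℚ + x) (ℕ→ℚ-+ a b) ⟩
  1ℚ + (ℕ→ℚ a + ℕ→ℚ b)       ≡⟨ sym (+-assoc 1ℚ (ℕ→ℚ a) (ℕ→ℚ b)) ⟩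
  1ℚ + ℕ→ℚ a + ℕ→ℚ b         ≡⟨ cong (_+ ℕ→ℚ b) (sym (ℕ→ℚ-suc a)) ⟩
  ℕ→ℚ (suc a) + ℕ→ℚ b        ∎
  where open ≡-Reasoning

ℕ→ℚ-* : ∀ a b → ℕ→ℚ (a ℕ.* b) ≡ ℕ→ℚ a * ℕ→ℚ b
ℕ→ℚ-* zero    b = sym (*-zeroˡ (ℕ→ℚ b))
ℕ→ℚ-* (suc a) b = begin
  ℕ→ℚ (b ℕ.+ a ℕ.* b)             ≡⟨ ℕ→ℚ-+ b (a ℕ.* b) ⟩
  ℕ→ℚ b + ℕ→ℚ (a ℕ.* b)           ≡⟨ cong (λ x → ℕ→ℚ b + x) (ℕ→ℚ-* a b) ⟩
  ℕ→ℚ b + ℕ→ℚ a * ℕ→ℚ b           ≡⟨ solve 2 (λ a b → b :+ a :* b := (con 1ℚ :+ a) :* b) refl (ℕ→ℚ a) (ℕ→ℚ b) ⟩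
  (1ℚ + ℕ→ℚ a) * ℕ→ℚ b            ≡⟨ cong (_* ℕ→ℚ b) (sym (ℕ→ℚ-suc a)) ⟩
  ℕ→ℚ (suc a) * ℕ→ℚ b             ∎
  where open ≡-Reasoning

ℕ→ℚ-nonNeg : ∀ k → 0ℚ ≤ ℕ→ℚ k
ℕ→ℚ-nonNeg k = nonNegative⁻¹ (ℕ→ℚ k) {{normalize-nonNeg k 1}}

ℕ→ℚ-pos : ∀ k → Positive (ℕ→ℚ (suc k))
ℕ→ℚ-pos k = normalize-pos (suc k) 1

ℕ→ℚ-mono-≤ : ∀ {a b} → a ℕ.≤ b → ℕ→ℚ a ≤ ℕ→ℚ b
ℕ→ℚ-mono-≤ {a} {b} a≤b = begin
  ℕ→ℚ a                       ≡⟨ sym (+-identityʳ (ℕ→ℚ a)) ⟩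
  ℕ→ℚ a + 0ℚ                  ≤⟨ +-monoʳ-≤ (ℕ→ℚ a) (ℕ→ℚ-nonNeg (b ℕ.∸ a)) ⟩
  ℕ→ℚ a + ℕ→ℚ (b ℕ.∸ a)       ≡⟨ sym (ℕ→ℚ-+ a (b ℕ.∸ a)) ⟩
  ℕ→ℚ (a ℕ.+ (b ℕ.∸ a))       ≡⟨ cong ℕ→ℚ (ℕ.m+[n∸m]≡n a≤b) ⟩
  ℕ→ℚ b                       ∎
  where open ≤-Reasoning

p-q≤p : ∀ p {q} → 0ℚ ≤ q → p - q ≤ p
p-q≤p p {q} 0≤q = begin
  p - q     ≤⟨ +-monoʳ-≤ p (neg-antimono-≤ 0≤q) ⟩
  p - 0ℚ    ≡⟨ +-identityʳ p ⟩
  p         ∎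
  where open ≤-Reasoning

p≤q+r⇒p-r≤q : ∀ {p q r} → p ≤ q + r → p - r ≤ q
p≤q+r⇒p-r≤q {p} {q} {r} p≤q+r = begin
  p - r           ≤⟨ +-monoˡ-≤ (- r) p≤q+r ⟩
  q + r - r       ≡⟨ solve 2 (λ q r → q :+ r :- r := q) refl q r ⟩
  q               ∎
  where open ≤-Reasoning

p+p≤q+q⇒p≤q : ∀ {p q} → p + p ≤ q + q → p ≤ q
p+p≤q+q⇒p≤q {p} {q} 2p≤2q = *-cancelˡ-≤-pos (ℕ→ℚ 2) {{ℕ→ℚ-pos 1}}
  (subst₂ _≤_ (double p) (double q) 2p≤2q)
  where
  double : ∀ x → x + x ≡ ℕ→ℚ 2 * x
  double = solve 1 (λ x → x :+ x := con (ℕ→ℚ 2) :* x) refl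

≤-/-suc : ∀ {x} n d → ℕ→ℚ (suc d) * x ≤ ℕ→ℚ n → x ≤ + n / suc d
≤-/-suc n d h = *-cancelˡ-≤-pos (ℕ→ℚ (suc d)) {{ℕ→ℚ-pos d}}
  (≤-trans h (≤-reflexive (sym (ℕ→ℚ-*-/ n d))))

archimedean : ∀ {ε} → 0ℚ < ε → Σ ℕ λ q → 1ℚ ≤ ℕ→ℚ (suc q) * ε
archimedean {mkℚ +[1+ p ] d _} _ = d , (begin
  1ℚ                           ≤⟨ ℕ→ℚ-mono-≤ {1} {suc p} (s≤s z≤n) ⟩
  ℕ→ℚ (suc p)                  ≡⟨ sym (ℕ→ℚ-*-/ (suc p) d) ⟩
  ℕ→ℚ (suc d) * (+ suc p / suc d) ≡⟨ cong (ℕ→ℚ (suc d) *_) (fromℚᵘ-toℚᵘ _) ⟩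
  ℕ→ℚ (suc d) * _              ∎)
  where open ≤-Reasoning
archimedean {mkℚ (+ zero) _ _}    0<ε with () ← positive 0<ε
archimedean {mkℚ ℤ.-[1+ _ ] _ _} 0<ε with () ← positive 0<ε

𝟙 : Bool → ℕ
𝟙 b = if b then 1 else 0

∑-const : ∀ n c → ∑[ i < n ] c ≡ n ℕ.* c
∑-const zero    c = refl
∑-const (suc n) c = cong (c ℕ.+_) (∑-const n c)

∑-mono-≤ : ∀ {n} {f g : Fin n → ℕ} → (∀ i → f i ℕ.≤ g i) → ∑[ i < n ] f i ℕ.≤ ∑[ i < n ] g i
∑-mono-≤ {zero}  f≤g = z≤n
∑-mono-≤ {suc n} f≤g = ℕ.+-mono-≤ (f≤g zero) (∑-mono-≤ (f≤g ∘ suc))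

sum-tabulate : ∀ n (f : Fin n → ℕ) → sumᴸ (List.tabulate f) ≡ ∑[ i < n ] f i
sum-tabulate zero    f = refl
sum-tabulate (suc n) f = cong (f zero ℕ.+_) (sum-tabulate n (f ∘ suc))

sum-map-allFin : ∀ n (f : Fin n → ℕ) → sumᴸ (List.map f (List.allFin n)) ≡ ∑[ i < n ] f i
sum-map-allFin n f = trans (cong sumᴸ (List.map-tabulate id f)) (sum-tabulate n f)

∣p∣≡∑𝟙 : ∀ {n} (p : Subset n) → ∣ p ∣ ≡ ∑[ x < n ] 𝟙 (lookup p x)
∣p∣≡∑𝟙 []          = refl
∣p∣≡∑𝟙 (true  ∷ p) = cong suc (∣p∣≡∑𝟙 p)
∣p∣≡∑𝟙 (false ∷ p) = ∣p∣≡∑𝟙 p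

∣tabulate∣≡∑𝟙 : ∀ {n} (g : Fin n → Bool) → ∣ tabulate g ∣ ≡ ∑[ x < n ] 𝟙 (g x)
∣tabulate∣≡∑𝟙 g = trans (∣p∣≡∑𝟙 (tabulate g)) (sum-cong-≗ (cong 𝟙 ∘ lookup∘tabulate g))

∈-tabulate⁺ : ∀ {n} {g : Fin n → Bool} {x} → g x ≡ true → x ∈ tabulate g
∈-tabulate⁺ {g = g} {x} gx = lookup⇒[]= x (tabulate g) (trans (lookup∘tabulate g x) gx)

∈-tabulate⁻ : ∀ {n} {g : Fin n → Bool} {x} → x ∈ tabulate g → g x ≡ true
∈-tabulate⁻ {g = g} {x} x∈ = trans (sym (lookup∘tabulate g x)) ([]=⇒lookup x∈)

∈⇒0<∣p∣ : ∀ {n} {p : Subset n} {x} → x ∈ p → 0 ℕ.< ∣ p ∣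
∈⇒0<∣p∣ x∈p = ℕ.≤-<-trans z≤n (x∈p⇒∣p-x∣<∣p∣ x∈p)

∣p∣≤1⇒∈-unique : ∀ {n} {p : Subset n} {x y} → ∣ p ∣ ℕ.≤ 1 → x ∈ p → y ∈ p → x ≡ y
∣p∣≤1⇒∈-unique {p = p} {x} {y} ∣p∣≤1 x∈p y∈p with x ≟ y
... | yes x≡y = x≡y
... | no  x≢y = ⊥-elim (ℕ.<-irrefl refl (ℕ.≤-trans 2≤∣p∣ ∣p∣≤1))
  where
  y∈p-x : y ∈ p Subset.- x
  y∈p-x = x∈p∧x∉q⇒x∈p─q y∈p (x≢y ∘ sym ∘ x∈⁅y⁆⇒x≡y x)
  2≤∣p∣ : 2 ℕ.≤ ∣ p ∣
  2≤∣p∣ = ℕ.≤-trans (s≤s (∈⇒0<∣p∣ y∈p-x)) (x∈p⇒∣p-x∣<∣p∣ x∈p)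

⁅0,1⁆ : ∀ {k} → Subset (suc (suc k))
⁅0,1⁆ = inside ∷ inside ∷ ⊥

∈⁅0,1⁆⁻ : ∀ {k} {x : Fin (suc (suc k))} → x ∈ ⁅0,1⁆ → x ≡ zero ⊎ x ≡ suc zero
∈⁅0,1⁆⁻ here                = inj₁ refl
∈⁅0,1⁆⁻ (there here)        = inj₂ refl
∈⁅0,1⁆⁻ (there (there x∈⊥)) = contradiction x∈⊥ ∉⊥

-- Stars and complete graphs

star-adj : ∀ {k} → Fin (suc k) → Fin (suc k) → Bool
star-adj zero    zero    = false
star-adj zero    (suc _) = true
star-adj (suc _) zero    = true
star-adj (suc _) (suc _) = false

star-adj-sym : ∀ {k} (u v : Fin (suc k)) → star-adj u v ≡ star-adj v u
star-adj-sym zero    zero    = refl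
star-adj-sym zero    (suc _) = refl
star-adj-sym (suc _) zero    = refl
star-adj-sym (suc _) (suc _) = refl

star-adj-irrefl : ∀ {k} (u : Fin (suc k)) → star-adj u u ≡ false
star-adj-irrefl zero    = refl
star-adj-irrefl (suc _) = refl

star : ∀ k → Graph (suc k)
star k = record { adj = star-adj ; sym = star-adj-sym ; irrefl = star-adj-irrefl }

star-hub : ∀ {k} (y z : Fin (suc k)) → adj (star k) y z ≡ true → y ≡ zero ⊎ z ≡ zero
star-hub zero    _       _ = inj₁ refl
star-hub (suc _) zero    _ = inj₂ refl
star-hub (suc _) (suc _) ()

≟-sym : ∀ {n} (u v : Fin n) → does (u ≟ v) ≡ does (v ≟ u)
≟-sym u v with u ≟ v
... | yes refl = sym (dec-true (u ≟ u) refl)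
... | no  u≢v  = sym (dec-false (v ≟ u) (u≢v ∘ sym))

complete : ∀ n → Graph n
complete n = record
  { adj    = λ u v → not (does (u ≟ v))
  ; sym    = λ u v → cong not (≟-sym u v)
  ; irrefl = λ u → cong not (dec-true (u ≟ u) refl)
  }

e-∑ : ∀ {n} (G : Graph n) → e G ≡ ∑[ u < n ] ∑[ v < n ] 𝟙 ((toℕ u <ᵇ toℕ v) ∧ adj G u v)
e-∑ {n} G = trans (sum-map-allFin n (λ u → sumᴸ (List.map (edge? u) (List.allFin n))))
                   (sum-cong-≗ (λ u → sum-map-allFin n (edge? u)))
  where
  edge? : Fin n → Fin n → ℕ
  edge? u v = 𝟙 ((toℕ u <ᵇ toℕ v) ∧ adj G u v)

-- In e-star and e-complete-suc the row and the column of vertex 0 unfold definitionally.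
e-star : ∀ k → e (star k) ≡ k
e-star k = begin
  e (star k)                                                        ≡⟨ e-∑ (star k) ⟩
  ∑[ v < k ] 1 ℕ.+ ∑[ u < k ] ∑[ v < k ] 𝟙 ((toℕ u <ᵇ toℕ v) ∧ false)  ≡⟨ cong₂ ℕ._+_ (∑-const k 1) no-leaf-edges ⟩
  k ℕ.* 1 ℕ.+ 0                                                     ≡⟨ ℕ.+-identityʳ _ ⟩
  k ℕ.* 1                                                           ≡⟨ ℕ.*-identityʳ k ⟩
  k                                                                 ∎
  where
  open ≡-Reasoning
  no-leaf-edges : ∑[ u < k ] ∑[ v < k ] 𝟙 ((toℕ u <ᵇ toℕ v) ∧ false) ≡ 0
  no-leaf-edges = begin
    ∑[ u < k ] ∑[ v < k ] 𝟙 ((toℕ u <ᵇ toℕ v) ∧ false)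
      ≡⟨ sum-cong-≗ {k} (λ u → sum-cong-≗ {k} (λ v → cong 𝟙 (∧-zeroʳ _))) ⟩
    ∑[ u < k ] ∑[ v < k ] 0                             ≡⟨ sum-cong-≗ {k} (λ u → trans (∑-const k 0) (ℕ.*-zeroʳ k)) ⟩
    ∑[ u < k ] 0                                        ≡⟨ trans (∑-const k 0) (ℕ.*-zeroʳ k) ⟩
    0                                                   ∎

e-complete-suc : ∀ n → e (complete (suc n)) ≡ n ℕ.+ e (complete n)
e-complete-suc n = begin
  e (complete (suc n))                                                      ≡⟨ e-∑ (complete (suc n)) ⟩
  ∑[ v < n ] 1 ℕ.+ ∑[ u < n ] ∑[ v < n ] 𝟙 ((toℕ u <ᵇ toℕ v) ∧ not (does (u ≟ v)))
    ≡⟨ cong₂ ℕ._+_ (trans (∑-const n 1) (ℕ.*-identityʳ n)) (sym (e-∑ (complete n))) ⟩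
  n ℕ.+ e (complete n)                                                      ∎
  where open ≡-Reasoning

e-complete : ∀ n → e (complete (suc n)) ℕ.+ e (complete (suc n)) ≡ suc n ℕ.* n
e-complete zero    = refl
e-complete (suc n) = begin
  e (complete (2 ℕ.+ n)) ℕ.+ e (complete (2 ℕ.+ n))
    ≡⟨ cong₂ ℕ._+_ (e-complete-suc (suc n)) (e-complete-suc (suc n)) ⟩
  (suc n ℕ.+ E) ℕ.+ (suc n ℕ.+ E)                                  ≡⟨ regroup (suc n) E ⟩
  suc n ℕ.+ suc n ℕ.+ (E ℕ.+ E)                                    ≡⟨ cong (suc n ℕ.+ suc n ℕ.+_) (e-complete n) ⟩
  suc n ℕ.+ suc n ℕ.+ suc n ℕ.* n                                  ≡⟨ factor n ⟩
  (2 ℕ.+ n) ℕ.* suc n                                              ∎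
  where
  open ≡-Reasoning
  E = e (complete (suc n))
  regroup : ∀ a b → (a ℕ.+ b) ℕ.+ (a ℕ.+ b) ≡ a ℕ.+ a ℕ.+ (b ℕ.+ b)
  regroup = ℕ-Solver.solve-∀
  factor : ∀ m → suc m ℕ.+ suc m ℕ.+ suc m ℕ.* m ≡ (2 ℕ.+ m) ℕ.* suc m
  factor = ℕ-Solver.solve-∀

pair-model : ∀ {n k} (H : Graph n) (G : Graph (suc (suc k))) → adj G zero (suc zero) ≡ true → Model H G
pair-model H G 0~1 = record
  { μ    = λ _ → ⁅0,1⁆
  ; conn = λ _ → (zero , here) , path
  ; edge = λ _ _ _ → zero , suc zero , here , there here , 0~1
  }
  where
  1~0 : adj G (suc zero) zero ≡ true
  1~0 = trans (Graph.sym G (suc zero) zero) 0~1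
  path : ∀ x y → x ∈ ⁅0,1⁆ → y ∈ ⁅0,1⁆ → PathIn G ⁅0,1⁆ x y
  path x y x∈ y∈ with ∈⁅0,1⁆⁻ x∈ | ∈⁅0,1⁆⁻ y∈
  ... | inj₁ refl | inj₁ refl = here
  ... | inj₁ refl | inj₂ refl = step 0~1 (there here) here
  ... | inj₂ refl | inj₁ refl = step 1~0 here here
  ... | inj₂ refl | inj₂ refl = here

-- Packings of jumbled models

module _ {n m} {H : Graph n} {G : Graph m} where

  weighted : (Model H G → ℕ) → List (ℚ × Model H G) → ℚ
  weighted f []            = 0ℚ
  weighted f ((α , M) ∷ P) = α * ℕ→ℚ (f M) + weighted f P

  load≡weighted : ∀ P x → load P x ≡ weighted (λ M → mult M x) P
  load≡weighted []            x = refl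
  load≡weighted ((α , M) ∷ P) x = cong (λ w → α * ℕ→ℚ (mult M x) + w) (load≡weighted P x)

  weighted-zero : ∀ P → weighted (λ _ → 0) P ≡ 0ℚ
  weighted-zero []            = refl
  weighted-zero ((α , M) ∷ P) = cong₂ _+_ (*-zeroʳ α) (weighted-zero P)

  weighted-+ : ∀ f g P → weighted (λ M → f M ℕ.+ g M) P ≡ weighted f P + weighted g P
  weighted-+ f g []            = sym (+-identityʳ 0ℚ)
  weighted-+ f g ((α , M) ∷ P) = begin
    α * ℕ→ℚ (f M ℕ.+ g M) + weighted (λ M → f M ℕ.+ g M) P
      ≡⟨ cong₂ (λ x y → α * x + y) (ℕ→ℚ-+ (f M) (g M)) (weighted-+ f g P) ⟩
    α * (ℕ→ℚ (f M) + ℕ→ℚ (g M)) + (weighted f P + weighted g P)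
      ≡⟨ solve 5 (λ α a b x y → α :* (a :+ b) :+ (x :+ y) := (α :* a :+ x) :+ (α :* b :+ y))
               refl α (ℕ→ℚ (f M)) (ℕ→ℚ (g M)) (weighted f P) (weighted g P) ⟩
    (α * ℕ→ℚ (f M) + weighted f P) + (α * ℕ→ℚ (g M) + weighted g P)
      ∎
    where open ≡-Reasoning

  weighted-∑≤ : ∀ {k} (f : Fin k → Model H G → ℕ) P → (∀ x → weighted (f x) P ≤ 1ℚ) →
                weighted (λ M → ∑[ x < k ] f x M) P ≤ ℕ→ℚ k
  weighted-∑≤ {zero}  f P f≤1 = ≤-reflexive (weighted-zero P)
  weighted-∑≤ {suc k} f P f≤1 = begin
    weighted (λ M → f zero M ℕ.+ ∑[ x < k ] f (suc x) M) P
      ≡⟨ weighted-+ (f zero) (λ M → ∑[ x < k ] f (suc x) M) P ⟩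
    weighted (f zero) P + weighted (λ M → ∑[ x < k ] f (suc x) M) P
      ≤⟨ +-mono-≤ (f≤1 zero) (weighted-∑≤ (f ∘ suc) P (f≤1 ∘ suc)) ⟩
    1ℚ + ℕ→ℚ k
      ≡⟨ sym (ℕ→ℚ-suc k) ⟩
    ℕ→ℚ (suc k)
      ∎
    where open ≤-Reasoning

  total-nonNeg : ∀ {P : List (ℚ × Model H G)} → All (λ p → 0ℚ ≤ proj₁ p) P → 0ℚ ≤ total P
  total-nonNeg []          = ≤-refl
  total-nonNeg (0≤α ∷ 0≤P) = +-mono-≤ 0≤α (total-nonNeg 0≤P)

  *-total≤weighted : ∀ {c f} P → All (λ p → 0ℚ ≤ proj₁ p) P → (∀ M → c ≤ ℕ→ℚ (f M)) →
                     c * total P ≤ weighted f P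
  *-total≤weighted {c}     []            []          c≤f = ≤-reflexive (*-zeroʳ c)
  *-total≤weighted {c} {f} ((α , M) ∷ P) (0≤α ∷ 0≤P) c≤f = begin
    c * (α + total P)              ≡⟨ solve 3 (λ c α t → c :* (α :+ t) := α :* c :+ c :* t) refl c α (total P) ⟩
    α * c + c * total P
      ≤⟨ +-mono-≤ (*-monoˡ-≤-nonNeg α {{nonNegative 0≤α}} (c≤f M)) (*-total≤weighted P 0≤P c≤f) ⟩
    α * ℕ→ℚ (f M) + weighted f P   ∎
    where open ≤-Reasoning

  total-bound-at : ∀ {c} x P → Packing P → (∀ M → c ≤ ℕ→ℚ (mult M x)) → c * total P ≤ 1ℚ
  total-bound-at x P (0≤P , fits) c≤ =
    ≤-trans (*-total≤weighted P 0≤P c≤) (subst (_≤ 1ℚ) (load≡weighted P x) (fits x))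

  total-bound-∑ : ∀ {c} P → Packing P → (∀ M → c ≤ ℕ→ℚ (∑[ x < m ] mult M x)) → c * total P ≤ ℕ→ℚ m
  total-bound-∑ P (0≤P , fits) c≤ = ≤-trans (*-total≤weighted P 0≤P c≤)
    (weighted-∑≤ (λ x M → mult M x) P (λ x → subst (_≤ 1ℚ) (load≡weighted P x) (fits x)))

module _ {n m} {H : Graph n} {G : Graph m} (M : Model H G) where

  mult-∑ : ∀ x → mult M x ≡ ∑[ v < n ] 𝟙 (lookup (μ M v) x)
  mult-∑ x = sum-map-allFin n (λ v → 𝟙 (lookup (μ M v) x))

  ∑mult≡∑∣μ∣ : ∑[ x < m ] mult M x ≡ ∑[ v < n ] ∣ μ M v ∣
  ∑mult≡∑∣μ∣ = begin
    ∑[ x < m ] mult M x                           ≡⟨ sum-cong-≗ {m} mult-∑ ⟩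
    ∑[ x < m ] ∑[ v < n ] 𝟙 (lookup (μ M v) x)    ≡⟨ ∑-comm (λ x v → 𝟙 (lookup (μ M v) x)) ⟩
    ∑[ v < n ] ∑[ x < m ] 𝟙 (lookup (μ M v) x)    ≡⟨ sum-cong-≗ {n} (sym ∘ ∣p∣≡∑𝟙 ∘ μ M) ⟩
    ∑[ v < n ] ∣ μ M v ∣                          ∎
    where open ≡-Reasoning

  τ≤mult-at-hub : ∀ {k} c → (∀ y z → adj G y z ≡ true → y ≡ c ⊎ z ≡ c) → IsTau H k → k ℕ.≤ mult M c
  τ≤mult-at-hub c hub (_ , τ-minimal) =
    ℕ.≤-trans (τ-minimal C cover)
              (ℕ.≤-reflexive (trans (∣tabulate∣≡∑𝟙 (λ v → lookup (μ M v) c)) (sym (mult-∑ c))))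
    where
    C : Subset n
    C = tabulate (λ v → lookup (μ M v) c)
    cover : IsVertexCover H C
    cover u v u~v with edge M u v u~v
    ... | x , y , x∈ , y∈ , x~y with hub x y x~y
    ...   | inj₁ refl = inj₁ (∈-tabulate⁺ ([]=⇒lookup x∈))
    ...   | inj₂ refl = inj₂ (∈-tabulate⁺ ([]=⇒lookup y∈))

  singletons : Subset n
  singletons = tabulate (λ v → ∣ μ M v ∣ ≤ᵇ 1)

  singletons-colourable : ChiLe H singletons m
  singletons-colourable = point , proper
    where
    point : Fin n → Fin m
    point v = proj₁ (proj₁ (conn M v))
    point-unique : ∀ {v x} → v ∈ singletons → x ∈ μ M v → x ≡ point v
    point-unique {v} v∈ x∈ = ∣p∣≤1⇒∈-unique (ℕ.≤ᵇ⇒≤ _ 1 (Equivalence.from T-≡ (∈-tabulate⁻ v∈)))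
                                             x∈ (proj₂ (proj₁ (conn M v)))
    proper : ∀ u v → u ∈ singletons → v ∈ singletons → adj H u v ≡ true → point u ≢ point v
    proper u v u∈ v∈ u~v pu≡pv with edge M u v u~v
    ... | x , y , x∈ , y∈ , x~y = case trans (sym (irrefl G x)) x~x of λ ()
      where
      x~x : adj G x x ≡ true
      x~x = subst (λ z → adj G x z ≡ true)
                  (trans (point-unique v∈ y∈) (trans (sym pu≡pv) (sym (point-unique u∈ x∈)))) x~y

  n+n≤∑mult+α : ∀ {a} → IsAlpha H m a → n ℕ.+ n ℕ.≤ ∑[ x < m ] mult M x ℕ.+ a
  n+n≤∑mult+α {a} (_ , α-maximal) = begin
    n ℕ.+ n                                             ≡⟨ sym (trans (∑-const n 2) (twice n)) ⟩
    ∑[ v < n ] 2                                        ≤⟨ ∑-mono-≤ (λ v → 2≤s+𝟙[s≤1] (∈⇒0<∣p∣ (proj₂ (proj₁ (conn M v))))) ⟩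
    ∑[ v < n ] (size v ℕ.+ 𝟙 (size v ≤ᵇ 1))             ≡⟨ ∑-distrib-+ size (λ v → 𝟙 (size v ≤ᵇ 1)) ⟩
    ∑[ v < n ] size v ℕ.+ ∑[ v < n ] 𝟙 (size v ≤ᵇ 1)
      ≡⟨ cong₂ ℕ._+_ (sym ∑mult≡∑∣μ∣) (sym (∣tabulate∣≡∑𝟙 (λ v → size v ≤ᵇ 1))) ⟩
    ∑[ x < m ] mult M x ℕ.+ ∣ singletons ∣              ≤⟨ ℕ.+-monoʳ-≤ _ (α-maximal singletons singletons-colourable) ⟩
    ∑[ x < m ] mult M x ℕ.+ a                           ∎
    where
    open ℕ.≤-Reasoning
    size : Fin n → ℕ
    size v = ∣ μ M v ∣
    twice : ∀ k → k ℕ.* 2 ≡ k ℕ.+ k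
    twice = ℕ-Solver.solve-∀
    2≤s+𝟙[s≤1] : ∀ {s} → 0 ℕ.< s → 2 ℕ.≤ s ℕ.+ 𝟙 (s ≤ᵇ 1)
    2≤s+𝟙[s≤1] {suc zero}    _ = s≤s (s≤s z≤n)
    2≤s+𝟙[s≤1] {suc (suc s)} _ = s≤s (s≤s z≤n)

-- The two bounds

τ-arith : ∀ {c r k ε T} → 0ℚ ≤ c → 0ℚ ≤ T → 0ℚ ≤ k → c * r ≡ 1ℚ + k → 1ℚ ≤ r * ε → c * T ≤ 1ℚ →
          (c * r) * ((c - ε) * T) ≤ k
τ-arith {c} {r} {k} {ε} {T} 0≤c 0≤T 0≤k cr≡1+k 1≤rε cT≤1 = begin
  (c * r) * ((c - ε) * T)
    ≡⟨ solve 4 (λ c r ε T → (c :* r) :* ((c :- ε) :* T) := (c :* r) :* (c :* T) :- (r :* ε) :* (c :* T))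
               refl c r ε T ⟩
  (c * r) * (c * T) - (r * ε) * (c * T)        ≡⟨ cong (λ x → x * (c * T) - (r * ε) * (c * T)) cr≡1+k ⟩
  (1ℚ + k) * (c * T) - (r * ε) * (c * T)
    ≤⟨ +-monoʳ-≤ ((1ℚ + k) * (c * T)) (neg-antimono-≤ (*-monoʳ-≤-nonNeg (c * T) {{0≤cT}} 1≤rε)) ⟩
  (1ℚ + k) * (c * T) - 1ℚ * (c * T)
    ≡⟨ solve 2 (λ k x → (con 1ℚ :+ k) :* x :- con 1ℚ :* x := k :* x) refl k (c * T) ⟩
  k * (c * T)                                  ≤⟨ *-monoˡ-≤-nonNeg k {{nonNegative 0≤k}} cT≤1 ⟩
  k * 1ℚ                                       ≡⟨ *-identityʳ k ⟩
  k                                            ∎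
  where
  open ≤-Reasoning
  0≤cT = nonNeg*nonNeg⇒nonNeg c {{nonNegative 0≤c}} T {{nonNegative 0≤T}}

star-bound : ∀ {n t r K ε} {H : Graph n} → suc K ≡ t ℕ.* r → IsTau H t → 1ℚ ≤ ℕ→ℚ r * ε →
             ∀ (P : List (ℚ × Model H (star K))) → Packing P → (ℕ→ℚ t - ε) * total P ≤ d (star K)
star-bound {t = t} {r} {K} {ε} K+1≡tr τ 1≤rε P pk =
  subst (λ E → (ℕ→ℚ t - ε) * total P ≤ + E / suc K) (sym (e-star K))
    (≤-/-suc K K (subst (λ x → x * ((ℕ→ℚ t - ε) * total P) ≤ ℕ→ℚ K) (sym K+1≡tr′)
      (τ-arith (ℕ→ℚ-nonNeg t) (total-nonNeg (proj₁ pk)) (ℕ→ℚ-nonNeg K)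
               (trans (sym K+1≡tr′) (ℕ→ℚ-suc K)) 1≤rε tT≤1)))
  where
  K+1≡tr′ : ℕ→ℚ (suc K) ≡ ℕ→ℚ t * ℕ→ℚ r
  K+1≡tr′ = trans (cong ℕ→ℚ K+1≡tr) (ℕ→ℚ-* t r)
  tT≤1 : ℕ→ℚ t * total P ≤ 1ℚ
  tT≤1 = total-bound-at zero P pk (λ M → ℕ→ℚ-mono-≤ (τ≤mult-at-hub M zero star-hub τ))

α-arith : ∀ {r n a E T ε} → 0ℚ ≤ T → 0ℚ ≤ ε → E ℕ.+ E ≡ suc r ℕ.* r →
          (ℕ→ℚ (n ℕ.+ n) - ℕ→ℚ a) * T ≤ ℕ→ℚ (suc r) →
          ((+ r / suc r) * (ℕ→ℚ n - + a / 2) - ε) * T ≤ + E / suc r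
α-arith {r} {n} {a} {E} {T} {ε} 0≤T 0≤ε E+E≡ 2x≤r+1 = begin
  (ρ * h - ε) * T      ≤⟨ *-monoʳ-≤-nonNeg T {{nonNegative 0≤T}} (p-q≤p (ρ * h) 0≤ε) ⟩
  (ρ * h) * T          ≤⟨ ≤-/-suc E r (begin
    ℕ→ℚ (suc r) * ((ρ * h) * T)
      ≡⟨ solve 4 (λ s ρ h T → s :* ((ρ :* h) :* T) := (s :* ρ) :* (h :* T)) refl (ℕ→ℚ (suc r)) ρ h T ⟩
    (ℕ→ℚ (suc r) * ρ) * x         ≡⟨ cong (_* x) (ℕ→ℚ-*-/ r r) ⟩
    ℕ→ℚ r * x                     ≤⟨ p+p≤q+q⇒p≤q rx+rx≤E+E ⟩
    ℕ→ℚ E                         ∎) ⟩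
  + E / suc r          ∎
  where
  open ≤-Reasoning
  ρ = + r / suc r
  h = ℕ→ℚ n - + a / 2
  x = h * T
  x+x≡ : x + x ≡ (ℕ→ℚ (n ℕ.+ n) - ℕ→ℚ a) * T
  x+x≡ = begin-equality
    x + x
      ≡⟨ solve 3 (λ n b T → (n :- b) :* T :+ (n :- b) :* T := (n :+ n :- con (ℕ→ℚ 2) :* b) :* T)
                 refl (ℕ→ℚ n) (+ a / 2) T ⟩
    (ℕ→ℚ n + ℕ→ℚ n - ℕ→ℚ 2 * (+ a / 2)) * T                ≡⟨ cong₂ (λ u v → (u - v) * T) (sym (ℕ→ℚ-+ n n)) (ℕ→ℚ-*-/ a 1) ⟩
    (ℕ→ℚ (n ℕ.+ n) - ℕ→ℚ a) * T                            ∎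
  rx+rx≤E+E : ℕ→ℚ r * x + ℕ→ℚ r * x ≤ ℕ→ℚ E + ℕ→ℚ E
  rx+rx≤E+E = begin
    ℕ→ℚ r * x + ℕ→ℚ r * x        ≡⟨ sym (*-distribˡ-+ (ℕ→ℚ r) x x) ⟩
    ℕ→ℚ r * (x + x)
      ≤⟨ *-monoˡ-≤-nonNeg (ℕ→ℚ r) {{nonNegative (ℕ→ℚ-nonNeg r)}} (subst (_≤ ℕ→ℚ (suc r)) (sym x+x≡) 2x≤r+1) ⟩
    ℕ→ℚ r * ℕ→ℚ (suc r)          ≡⟨ *-comm (ℕ→ℚ r) (ℕ→ℚ (suc r)) ⟩
    ℕ→ℚ (suc r) * ℕ→ℚ r          ≡⟨ sym (ℕ→ℚ-* (suc r) r) ⟩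
    ℕ→ℚ (suc r ℕ.* r)            ≡⟨ cong ℕ→ℚ (sym E+E≡) ⟩
    ℕ→ℚ (E ℕ.+ E)                ≡⟨ ℕ→ℚ-+ E E ⟩
    ℕ→ℚ E + ℕ→ℚ E                ∎

complete-bound : ∀ {n r a ε} {H : Graph n} → 0ℚ ≤ ε → IsAlpha H (suc r) a →
                 ∀ (P : List (ℚ × Model H (complete (suc r)))) → Packing P →
                 ((+ r / suc r) * (ℕ→ℚ n - + a / 2) - ε) * total P ≤ d (complete (suc r))
complete-bound {n} {r} {a} 0≤ε α P pk =
  α-arith {r} {n} {a} {e (complete (suc r))} (total-nonNeg (proj₁ pk)) 0≤ε (e-complete r)
          (total-bound-∑ P pk volume)
  where
  volume : ∀ M → ℕ→ℚ (n ℕ.+ n) - ℕ→ℚ a ≤ ℕ→ℚ (∑[ x < suc r ] mult M x)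
  volume M = p≤q+r⇒p-r≤q (≤-trans (ℕ→ℚ-mono-≤ (n+n≤∑mult+α M α))
                                  (≤-reflexive (ℕ→ℚ-+ (∑[ x < suc r ] mult M x) a)))

d-nonNeg : ∀ {m} (G : Graph (suc m)) → 0ℚ ≤ d G
d-nonNeg {m} G = nonNegative⁻¹ (d G) {{normalize-nonNeg (e G) (suc m)}}

lemma3p3 : ∀ {n} (H : Graph n) (s : ℚ) → CTCandidate H s →
    (ε : ℚ) → 0ℚ < ε →
    Σ ℕ λ m → Σ (Graph (suc m)) λ G →
      Model H G ×
      (∀ (P : List (ℚ × Model H G)) → Packing P → (s - ε) * total P ≤ d G)
lemma3p3 H s (inj₁ (zero , _ , refl)) ε 0<ε = 1 , star 1 , pair-model H (star 1) refl , bound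
  where
  bound : ∀ P → Packing P → (0ℚ - ε) * total P ≤ d (star 1)
  bound P (0≤P , _) = begin
    (0ℚ - ε) * total P
      ≤⟨ *-monoʳ-≤-nonNeg (total P) {{nonNegative (total-nonNeg 0≤P)}} (p-q≤p 0ℚ (<⇒≤ 0<ε)) ⟩
    0ℚ * total P         ≡⟨ *-zeroˡ (total P) ⟩
    0ℚ                   ≤⟨ d-nonNeg (star 1) ⟩
    d (star 1)           ∎
    where open ≤-Reasoning
-- For τ(H) = k + 1 the star has (k + 1)(q + 2) vertices, where (q + 1)ε ≥ 1.
lemma3p3 H s (inj₁ (suc k , τ , refl)) ε 0<ε with archimedean 0<ε
... | q , 1≤qε = suc q ℕ.+ k ℕ.* suc (suc q) , star _ , pair-model H (star _) refl , star-bound refl τ 1≤rε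
  where
  1≤rε : 1ℚ ≤ ℕ→ℚ (suc (suc q)) * ε
  1≤rε = ≤-trans 1≤qε (*-monoʳ-≤-nonNeg ε {{nonNegative (<⇒≤ 0<ε)}} (ℕ→ℚ-mono-≤ (ℕ.n≤1+n (suc q))))
lemma3p3 H s (inj₂ (j , a , α , refl)) ε 0<ε =
  suc j , complete (suc (suc j)) , pair-model H (complete (suc (suc j))) refl , complete-bound (<⇒≤ 0<ε) α
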